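{- Let $\pi$ be a permutation of $[n]$ avoiding $2341$, $4123$ and $3412$, in which the entry $n$ appears before the entry $1$. Then $\pi$ has one of the following two forms (where any of the pieces may be empty): (i) there are positions $0=p_0\le p_1\le p_2\le p_3\le p_4\le p_5=n$ and values $0\le q_1\le q_2\le n$ such that for each $k\in\{1,\dots,5\}$ the segment $\pi(p_{k-1}+1)\cdots\pi(p_k)$ is decreasing, the entries of the first and fourth segments have values in $\{1,\dots,q_1\}$, the entries of the third segment have values in $\{q_1+1,\dots,q_2\}$, and the entries of the second and fifth segments have values in $\{q_2+1,\dots,n\}$; (ii) there is $q\in\{0,\dots,n\}$ such that the entries of $\pi$ with values in $\{1,\dots,q\}$ form a decreasing subsequence and the entries with values in $\{q+1,\dots,n\}$ form a decreasing subsequence.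
   Context: A permutation $\pi$ contains $\tau$ if $\pi$ has a subsequence order-isomorphic to $\tau$; otherwise it avoids $\tau$. -}

module Defs where

open import Data.Nat using (ℕ; zero; suc; _≤_; _<_; _∸_)
open import Data.Fin using (Fin; toℕ; #_)
open import Data.Fin.Permutation using (Permutation′; _⟨$⟩ʳ_)
open import Data.Vec using (Vec; lookup; _∷_; [])
open import Data.Product using (Σ; ∃; _×_; _,_)
open import Data.Sum using (_⊎_)
open import Data.Empty using (⊥)
open import Relation.Binary.PropositionalEquality using (_≡_)
open import Function.Bundles using (_⇔_)

-- Conventions: a permutation of [n] is a bijection Fin n → Fin n
-- (stdlib Permutation′ n); positions and values are 0-based
-- (position i ↔ paper position i+1, value v ↔ paper value v+1).

val : ∀ {n} → Permutation′ n → Fin n → ℕ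
val π i = toℕ (π ⟨$⟩ʳ i)

-- π contains the pattern τ (a permutation of [k], listed by its 0-based
-- values): there are positions e 0 < e 1 < ... < e (k-1) such that the
-- subsequence π(e 0) ... π(e (k-1)) is order-isomorphic to τ.
Contains : ∀ {k n} → Vec (Fin k) k → Permutation′ n → Set
Contains {k} {n} τ π =
  Σ (Fin k → Fin n) λ e →
    (∀ a b → toℕ a < toℕ b → toℕ (e a) < toℕ (e b)) ×
    (∀ a b → (toℕ (lookup τ a) < toℕ (lookup τ b)) ⇔ (val π (e a) < val π (e b)))

Avoids : ∀ {k n} → Vec (Fin k) k → Permutation′ n → Set
Avoids τ π = Contains τ π → ⊥

p2341 : Vec (Fin 4) 4
p2341 = # 1 ∷ # 2 ∷ # 3 ∷ # 0 ∷ []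

p4123 : Vec (Fin 4) 4
p4123 = # 3 ∷ # 0 ∷ # 1 ∷ # 2 ∷ []

p3412 : Vec (Fin 4) 4
p3412 = # 2 ∷ # 3 ∷ # 0 ∷ # 1 ∷ []

NBefore1 : ∀ {n} → Permutation′ n → Set
NBefore1 {n} π = Σ (Fin n) λ i → Σ (Fin n) λ j →
  toℕ i < toℕ j × val π i ≡ n ∸ 1 × val π j ≡ 0

-- position i lies in the segment of (paper) positions a+1 .. b
InSeg : ∀ {n} → ℕ → ℕ → Fin n → Set
InSeg a b i = a ≤ toℕ i × toℕ i < b

DecSeg : ∀ {n} → Permutation′ n → ℕ → ℕ → Set
DecSeg {n} π a b = ∀ (i j : Fin n) → InSeg a b i → InSeg a b j →
  toℕ i < toℕ j → val π j < val π i

-- every entry of the segment π(a+1) ... π(b) has (paper) value in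
-- {lo+1, ..., hi}, i.e. 0-based value v with lo ≤ v < hi
SegValsIn : ∀ {n} → Permutation′ n → ℕ → ℕ → ℕ → ℕ → Set
SegValsIn {n} π a b lo hi = ∀ (i : Fin n) → InSeg a b i →
  lo ≤ val π i × val π i < hi

FormI : ∀ {n} → Permutation′ n → Set
FormI {n} π =
  Σ ℕ λ p₁ → Σ ℕ λ p₂ → Σ ℕ λ p₃ → Σ ℕ λ p₄ → Σ ℕ λ q₁ → Σ ℕ λ q₂ →
    (p₁ ≤ p₂ × p₂ ≤ p₃ × p₃ ≤ p₄ × p₄ ≤ n) ×
    (q₁ ≤ q₂ × q₂ ≤ n) ×
    (DecSeg π 0 p₁ × DecSeg π p₁ p₂ × DecSeg π p₂ p₃ × DecSeg π p₃ p₄ × DecSeg π p₄ n) ×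
    (SegValsIn π 0 p₁ 0 q₁ × SegValsIn π p₃ p₄ 0 q₁ ×
     SegValsIn π p₂ p₃ q₁ q₂ ×
     SegValsIn π p₁ p₂ q₂ n × SegValsIn π p₄ n q₂ n)

FormII : ∀ {n} → Permutation′ n → Set
FormII {n} π = Σ ℕ λ q → q ≤ n ×
  (∀ (i j : Fin n) → toℕ i < toℕ j → val π i < q → val π j < q → val π j < val π i) ×
  (∀ (i j : Fin n) → toℕ i < toℕ j → q ≤ val π i → q ≤ val π j → val π j < val π i)

module Submission where

open import Defs
open import Data.Nat using (ℕ; zero; suc; _≤_; _<_; z≤n; s≤s; z<s; _<?_; _≤?_)
open import Data.Nat.Properties
open import Data.Nat.Induction using (<-wellFounded)
open import Data.Fin using (Fin; toℕ; fromℕ; fromℕ<; zero; suc)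
open import Data.Fin.Properties using (toℕ-injective; toℕ<n; toℕ-fromℕ; toℕ-fromℕ<; fromℕ<-toℕ; toℕ≤pred[n])
open import Data.Fin.Permutation using (Permutation′)
open import Data.Vec using (Vec; lookup; map; _∷_; [])
open import Data.Vec.Properties using (lookup-map)
open import Data.Product using (∃; _×_; _,_)
open import Data.Empty using (⊥; ⊥-elim)
open import Data.Sum using (_⊎_; inj₁; inj₂)
open import Function.Bundles using (Injection; mk⇔)
open import Function.Properties.Inverse using (↔⇒↣)
open import Induction.WellFounded using (Acc; acc)
open import Relation.Binary.Definitions using (Tri; tri<; tri≈; tri>)
open import Relation.Binary.PropositionalEquality
open import Relation.Nullary using (¬_; yes; no; contradiction)
open import Relation.Nullary.Decidable using (_×-dec_; _→-dec_)
open import Relation.Unary using (Pred; Decidable)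

-- Let n stand at position a and 1 at position b > a. Entries before n decrease (an ascent there
-- would complete 2341 with n and 1), and so do entries after 1 (else 4123 with n).
-- If 1 is last, π avoids 123 and 3412. Take q least bounding the bottoms of all ascents: if no
-- ascent lies below q, the values below and above q form two decreasing sequences (form (ii));
-- otherwise two ascents, one above the other, make a 3142 that cuts π into two decreasing runs.
-- If 1 is not last and the entries between n and 1 decrease, the first entry of π is a value
-- threshold cutting them into the second and fourth pieces of form (i). If they contain an ascent,
-- the value of the last entry splits π into two decreasing sequences (form (ii)).

Increasing : ∀ {k} → Vec ℕ k → Set
Increasing xs = ∀ a b → toℕ a < toℕ b → lookup xs a < lookup xs b

increasing-reflects : ∀ {k} {xs : Vec ℕ k} → Increasing xs → ∀ a b → lookup xs a < lookup xs b → toℕ a < toℕ b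
increasing-reflects {xs = xs} inc a b xa<xb with <-cmp (toℕ a) (toℕ b)
... | tri< a<b _ _ = a<b
... | tri≈ _ a≡b _ = contradiction (cong (lookup xs) (toℕ-injective a≡b)) (<⇒≢ xa<xb)
... | tri> _ _ b<a = contradiction (inc b a b<a) (<⇒≯ xa<xb)

increasing-≤-last : ∀ {k} {xs : Vec ℕ (suc k)} → Increasing xs → ∀ a → lookup xs a ≤ lookup xs (fromℕ k)
increasing-≤-last {k} inc a with m≤n⇒m<n∨m≡n (toℕ≤pred[n] a)
... | inj₁ a<k = <⇒≤ (inc a (fromℕ k) (subst (toℕ a <_) (sym (toℕ-fromℕ k)) a<k))
... | inj₂ a≡k = ≤-reflexive (cong _ (toℕ-injective (trans a≡k (sym (toℕ-fromℕ k)))))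

increasing₄ : ∀ {s t u w} → s < t → t < u → u < w → Increasing (s ∷ t ∷ u ∷ w ∷ [])
increasing₄ s<t t<u u<w = λ where
  zero (suc zero) _ → s<t
  zero (suc (suc zero)) _ → <-trans s<t t<u
  zero (suc (suc (suc zero))) _ → <-trans s<t (<-trans t<u u<w)
  (suc zero) (suc (suc zero)) _ → t<u
  (suc zero) (suc (suc (suc zero))) _ → <-trans t<u u<w
  (suc (suc zero)) (suc (suc (suc zero))) _ → u<w
  _ zero ()
  (suc zero) (suc zero) (s≤s ())
  (suc (suc zero)) (suc zero) (s≤s ())
  (suc (suc zero)) (suc (suc zero)) (s≤s (s≤s ()))
  (suc (suc (suc zero))) (suc zero) (s≤s ())
  (suc (suc (suc zero))) (suc (suc zero)) (s≤s (s≤s ()))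
  (suc (suc (suc zero))) (suc (suc (suc zero))) (s≤s (s≤s (s≤s ())))

module _ {p} {P : Pred ℕ p} (P? : Decidable P) where

  least : ∀ {k} → P k → ∃ λ m → m ≤ k × P m × (∀ {i} → i < m → ¬ P i)
  least {k} = go (<-wellFounded k)
    where
    go : ∀ {k} → Acc _<_ k → P k → ∃ λ m → m ≤ k × P m × (∀ {i} → i < m → ¬ P i)
    go {k} (acc rec) Pk with anyUpTo? P? k
    ... | no none = k , ≤-refl , Pk , λ i<k Pi → none (_ , i<k , Pi)
    ... | yes (m , m<k , Pm) with go (rec m<k) Pm
    ...   | r , r≤m , Pr , minimal = r , ≤-trans r≤m (<⇒≤ m<k) , Pr , minimal

module Values {n} (π : Permutation′ n) where

  -- Positions are handled as naturals; beyond the last position the value is junk (0).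
  v : ℕ → ℕ
  v k with k <? n
  ... | yes k<n = val π (fromℕ< k<n)
  ... | no _ = 0

  v-fromℕ< : ∀ {k} (k<n : k < n) → v k ≡ val π (fromℕ< k<n)
  v-fromℕ< {k} k<n with k <? n
  ... | yes _ = refl
  ... | no k≮n = contradiction k<n k≮n

  v-toℕ : ∀ i → v (toℕ i) ≡ val π i
  v-toℕ i = trans (v-fromℕ< (toℕ<n i)) (cong (val π) (fromℕ<-toℕ i (toℕ<n i)))

  v<n : ∀ {k} → k < n → v k < n
  v<n k<n = subst (_< n) (sym (v-fromℕ< k<n)) (toℕ<n _)

  v-injective : ∀ {k l} → k < n → l < n → v k ≡ v l → k ≡ l
  v-injective k<n l<n vk≡vl = begin
    _                  ≡⟨ toℕ-fromℕ< k<n ⟨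
    toℕ (fromℕ< k<n)   ≡⟨ cong toℕ (Injection.injective (↔⇒↣ π) (toℕ-injective πk≡πl)) ⟩
    toℕ (fromℕ< l<n)   ≡⟨ toℕ-fromℕ< l<n ⟩
    _                  ∎
    where
    open ≡-Reasoning
    πk≡πl : val π (fromℕ< k<n) ≡ val π (fromℕ< l<n)
    πk≡πl = trans (sym (v-fromℕ< k<n)) (trans vk≡vl (v-fromℕ< l<n))

  v-descends : ∀ {s t} → s < t → t < n → ¬ v s < v t → v t < v s
  v-descends {s} {t} s<t t<n vs≮vt with <-cmp (v s) (v t)
  ... | tri< vs<vt _ _ = contradiction vs<vt vs≮vt
  ... | tri≈ _ vs≡vt _ = contradiction (v-injective (<-trans s<t t<n) t<n vs≡vt) (<⇒≢ s<t)
  ... | tri> _ _ vt<vs = vt<vs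

  v-ascends : ∀ {s t} → s < t → t < n → ¬ v t < v s → v s < v t
  v-ascends {s} {t} s<t t<n vt≮vs with <-cmp (v s) (v t)
  ... | tri< vs<vt _ _ = vs<vt
  ... | tri≈ _ vs≡vt _ = contradiction (v-injective (<-trans s<t t<n) t<n vs≡vt) (<⇒≢ s<t)
  ... | tri> _ _ vt<vs = contradiction vt<vs vt≮vs

  occurrence : ∀ {k} (τ : Vec (Fin k) k) (ps xs : Vec ℕ k) → Increasing ps → (∀ a → lookup ps a < n) →
               Increasing xs → map v ps ≡ map (lookup xs) τ → Contains τ π
  occurrence τ ps xs ps↑ ps<n xs↑ ranks =
    e , e↑ , λ a b → mk⇔ (λ τa<τb → subst₂ _<_ (sym (val-e a)) (sym (val-e b)) (xs↑ _ _ τa<τb))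
                         (λ ea<eb → increasing-reflects {xs = xs} xs↑ _ _ (subst₂ _<_ (val-e a) (val-e b) ea<eb))
    where
    open ≡-Reasoning
    e : Fin _ → Fin n
    e a = fromℕ< (ps<n a)
    e↑ : ∀ a b → toℕ a < toℕ b → toℕ (e a) < toℕ (e b)
    e↑ a b a<b = subst₂ _<_ (sym (toℕ-fromℕ< (ps<n a))) (sym (toℕ-fromℕ< (ps<n b))) (ps↑ a b a<b)
    val-e : ∀ a → val π (e a) ≡ lookup xs (lookup τ a)
    val-e a = begin
      val π (e a)                    ≡⟨ v-fromℕ< (ps<n a) ⟨
      v (lookup ps a)                ≡⟨ lookup-map a v ps ⟨
      lookup (map v ps) a            ≡⟨ cong (λ ys → lookup ys a) ranks ⟩
      lookup (map (lookup xs) τ) a   ≡⟨ lookup-map a (lookup xs) τ ⟩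
      lookup xs (lookup τ a)         ∎

  occurrence₄ : ∀ (τ : Vec (Fin 4) 4) {s t u w x₀ x₁ x₂ x₃} →
                s < t → t < u → u < w → w < n → x₀ < x₁ → x₁ < x₂ → x₂ < x₃ →
                map v (s ∷ t ∷ u ∷ w ∷ []) ≡ map (lookup (x₀ ∷ x₁ ∷ x₂ ∷ x₃ ∷ [])) τ → Contains τ π
  occurrence₄ τ {s} {t} {u} {w} {x₀} {x₁} {x₂} {x₃} s<t t<u u<w w<n x₀<x₁ x₁<x₂ x₂<x₃ =
    occurrence τ _ (x₀ ∷ x₁ ∷ x₂ ∷ x₃ ∷ []) ps↑ (λ a → ≤-<-trans (increasing-≤-last {xs = s ∷ t ∷ u ∷ w ∷ []} ps↑ a) w<n)
               (increasing₄ x₀<x₁ x₁<x₂ x₂<x₃)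
    where
    ps↑ : Increasing (s ∷ t ∷ u ∷ w ∷ [])
    ps↑ = increasing₄ s<t t<u u<w

  module _ {s t u w} (s<t : s < t) (t<u : t < u) (u<w : u < w) (w<n : w < n) where

    ¬2341 : Avoids p2341 π → v w < v s → v s < v t → v t < v u → ⊥
    ¬2341 av x₀<x₁ x₁<x₂ x₂<x₃ = av (occurrence₄ p2341 s<t t<u u<w w<n x₀<x₁ x₁<x₂ x₂<x₃ refl)

    ¬4123 : Avoids p4123 π → v t < v u → v u < v w → v w < v s → ⊥
    ¬4123 av x₀<x₁ x₁<x₂ x₂<x₃ = av (occurrence₄ p4123 s<t t<u u<w w<n x₀<x₁ x₁<x₂ x₂<x₃ refl)

    ¬3412 : Avoids p3412 π → v u < v w → v w < v s → v s < v t → ⊥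
    ¬3412 av x₀<x₁ x₁<x₂ x₂<x₃ = av (occurrence₄ p3412 s<t t<u u<w w<n x₀<x₁ x₁<x₂ x₂<x₃ refl)

  Avoids123 : Set
  Avoids123 = ∀ {s t u} → s < t → t < u → u < n → v s < v t → v t < v u → ⊥

  DecreasingOn : ℕ → ℕ → Set
  DecreasingOn a b = ∀ {s t} → a ≤ s → s < t → t < b → t < n → v t < v s

  ValuesIn : ℕ → ℕ → ℕ → ℕ → Set
  ValuesIn a b lo hi = ∀ {s} → a ≤ s → s < b → s < n → lo ≤ v s × v s < hi

  decreasingOn-empty : ∀ k → DecreasingOn k k
  decreasingOn-empty k k≤s s<t t<k _ = contradiction (≤-<-trans k≤s (<-trans s<t t<k)) (<-irrefl refl)

  valuesIn-empty : ∀ k lo hi → ValuesIn k k lo hi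
  valuesIn-empty k lo hi k≤s s<k _ = contradiction (≤-<-trans k≤s s<k) (<-irrefl refl)

  valuesIn-all : ∀ a b → ValuesIn a b 0 n
  valuesIn-all a b _ _ s<n = z≤n , v<n s<n

  decSeg : ∀ {a b} → DecreasingOn a b → DecSeg π a b
  decSeg dec i j (a≤i , _) (_ , j<b) i<j = subst₂ _<_ (v-toℕ j) (v-toℕ i) (dec a≤i i<j j<b (toℕ<n j))

  segValsIn : ∀ {a b lo hi} → ValuesIn a b lo hi → SegValsIn π a b lo hi
  segValsIn vals i (a≤i , i<b) with vals a≤i i<b (toℕ<n i)
  ... | lo≤vi , vi<hi = subst (_ ≤_) (v-toℕ i) lo≤vi , subst (_< _) (v-toℕ i) vi<hi

  formI : ∀ p₁ p₂ p₃ p₄ q₁ q₂ → p₁ ≤ p₂ → p₂ ≤ p₃ → p₃ ≤ p₄ → p₄ ≤ n → q₁ ≤ q₂ → q₂ ≤ n →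
          DecreasingOn 0 p₁ → DecreasingOn p₁ p₂ → DecreasingOn p₂ p₃ → DecreasingOn p₃ p₄ → DecreasingOn p₄ n →
          ValuesIn 0 p₁ 0 q₁ → ValuesIn p₃ p₄ 0 q₁ → ValuesIn p₂ p₃ q₁ q₂ → ValuesIn p₁ p₂ q₂ n → ValuesIn p₄ n q₂ n →
          FormI π
  formI p₁ p₂ p₃ p₄ q₁ q₂ p₁≤p₂ p₂≤p₃ p₃≤p₄ p₄≤n q₁≤q₂ q₂≤n d₁ d₂ d₃ d₄ d₅ w₁ w₄ w₃ w₂ w₅ =
    p₁ , p₂ , p₃ , p₄ , q₁ , q₂ , (p₁≤p₂ , p₂≤p₃ , p₃≤p₄ , p₄≤n) , (q₁≤q₂ , q₂≤n) ,
    (decSeg d₁ , decSeg d₂ , decSeg d₃ , decSeg d₄ , decSeg d₅) ,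
    (segValsIn w₁ , segValsIn w₄ , segValsIn w₃ , segValsIn w₂ , segValsIn w₅)

  twoRuns⇒formI : ∀ k → k ≤ n → DecreasingOn 0 k → DecreasingOn k n → FormI π
  twoRuns⇒formI k k≤n d₁ d₂ = formI 0 k k k 0 0 z≤n ≤-refl ≤-refl k≤n ≤-refl z≤n
    (decreasingOn-empty 0) d₁ (decreasingOn-empty k) (decreasingOn-empty k) d₂
    (valuesIn-empty 0 0 0) (valuesIn-empty k 0 0) (valuesIn-empty k 0 0) (valuesIn-all 0 k) (valuesIn-all k n)

  DecreasingBelow DecreasingAbove : ℕ → Set
  DecreasingBelow q = ∀ {s t} → s < t → t < n → v s < q → v t < q → v t < v s
  DecreasingAbove q = ∀ {s t} → s < t → t < n → q ≤ v s → q ≤ v t → v t < v s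

  formII : ∀ q → q ≤ n → DecreasingBelow q → DecreasingAbove q → FormII π
  formII q q≤n below above = q , q≤n ,
    (λ i j i<j vi<q vj<q → subst₂ _<_ (v-toℕ j) (v-toℕ i)
       (below i<j (toℕ<n j) (subst (_< q) (sym (v-toℕ i)) vi<q) (subst (_< q) (sym (v-toℕ j)) vj<q))) ,
    (λ i j i<j q≤vi q≤vj → subst₂ _<_ (v-toℕ j) (v-toℕ i)
       (above i<j (toℕ<n j) (subst (q ≤_) (sym (v-toℕ i)) q≤vi) (subst (q ≤_) (sym (v-toℕ j)) q≤vj)))

module Avoiding123And3412 {n} {π : Permutation′ n} (¬123 : Values.Avoids123 π) (av3412 : Avoids p3412 π) where
  open Values π

  AscentBottom : ℕ → Set
  AscentBottom s = ∃ λ t → t < n × s < t × v s < v t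

  ascentBottom? : Decidable AscentBottom
  ascentBottom? s = anyUpTo? (λ t → (s <? t) ×-dec (v s <? v t)) n

  BottomsBelow : ℕ → Set
  BottomsBelow q = ∀ {s} → s < n → AscentBottom s → v s < q

  bottomsBelow? : Decidable BottomsBelow
  bottomsBelow? q = allUpTo? (λ s → ascentBottom? s →-dec (v s <? q)) n

  LowAscent : ℕ → Set
  LowAscent q = ∃ λ t → t < n × ∃ λ s → s < t × v s < v t × v t < q

  lowAscent? : Decidable LowAscent
  lowAscent? q = anyUpTo? (λ t → anyUpTo? (λ s → (v s <? v t) ×-dec (v t <? q)) t) n

  ¬lowAscent⇒formII : ∀ q → q ≤ n → BottomsBelow q → ¬ LowAscent q → FormII π
  ¬lowAscent⇒formII q q≤n bottoms<q ¬low = formII q q≤n below above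
    where
    below : DecreasingBelow q
    below s<t t<n _ vt<q = v-descends s<t t<n λ vs<vt → ¬low (_ , t<n , _ , s<t , vs<vt , vt<q)
    above : DecreasingAbove q
    above s<t t<n q≤vs _ = v-descends s<t t<n λ vs<vt → <⇒≱ (bottoms<q (<-trans s<t t<n) (_ , t<n , s<t , vs<vt)) q≤vs

  -- Two ascents, the second lying weakly above the first, spread into a 3142 at positions u < s < k < t.
  module _ {s t u w} (s<t : s < t) (t<n : t < n) (vs<vt : v s < v t)
           (u<w : u < w) (w<n : w < n) (vu<vw : v u < v w) (vt≤vu : v t ≤ v u) where

    Exceeds-u : ℕ → Set
    Exceeds-u k = u < k × k < n × v u < v k

    module _ {k} (u<k : u < k) (k<n : k < n) (vu<vk : v u < v k)
             (first : ∀ {r} → r < k → ¬ Exceeds-u r) where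

      u<s : u < s
      u<s with <-cmp u s
      ... | tri< u<s _ _ = u<s
      ... | tri≈ _ u≡s _ = contradiction (subst (λ x → v t ≤ v x) u≡s vt≤vu) (<⇒≱ vs<vt)
      ... | tri> _ _ s<u = contradiction vu<vk (¬123 s<u u<k k<n (<-≤-trans vs<vt vt≤vu))

      vt<vu : v t < v u
      vt<vu = ≤∧≢⇒< vt≤vu λ vt≡vu → <⇒≢ (<-trans u<s s<t) (v-injective (<-trans u<w w<n) t<n (sym vt≡vu))

      s<k : s < k
      s<k with <-cmp s k
      ... | tri< s<k _ _ = s<k
      ... | tri≈ _ s≡k _ = contradiction (subst (λ x → v u < v x) (sym s≡k) vu<vk) (<-asym (<-trans vs<vt vt<vu))
      ... | tri> _ _ k<s = contradiction vu<vk (¬3412 u<k k<s s<t t<n av3412 vs<vt vt<vu)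

      decreasing-before-k : DecreasingOn 0 k
      decreasing-before-k {p} {r} _ p<r r<k r<n = v-descends p<r r<n λ vp<vr →
        let vk<vr = v-descends r<k k<n (¬123 p<r r<k k<n vp<vr) in ¬ascent vp<vr vk<vr (<-cmp u r)
        where
        ¬ascent : v p < v r → v k < v r → Tri (u < r) (u ≡ r) (r < u) → ⊥
        ¬ascent _ vk<vr (tri< u<r _ _) = first r<k (u<r , r<n , <-trans vu<vk vk<vr)
        ¬ascent _ vk<vr (tri≈ _ u≡r _) = <-asym vu<vk (subst (λ x → v k < v x) (sym u≡r) vk<vr)
        ¬ascent vp<vr _ (tri> _ _ r<u) = ¬3412 p<r (<-trans r<u u<s) s<t t<n av3412 vs<vt vt<vp vp<vr
          where
          vt<vp : v t < v p
          vt<vp = v-descends (<-trans p<r (<-trans r<u (<-trans u<s s<t))) t<n λ vp<vt →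
            ¬123 (<-trans p<r r<u) u<k k<n (<-trans vp<vt vt<vu) vu<vk

      decreasing-from-k : DecreasingOn k n
      decreasing-from-k {p} {r} k≤p p<r _ r<n = v-descends p<r r<n (¬ascent (m≤n⇒m<n∨m≡n k≤p))
        where
        ¬ascent : k < p ⊎ k ≡ p → ¬ v p < v r
        ¬ascent (inj₂ refl) vk<vr = ¬123 u<k p<r r<n vu<vk vk<vr
        ¬ascent (inj₁ k<p) vp<vr = ¬ascent-from-t (<-cmp t r)
          where
          p<n : p < n
          p<n = <-trans p<r r<n
          below-p : ∀ {x} → x < p → v p < v x
          below-p x<p = v-descends x<p p<n λ vx<vp → ¬123 x<p p<r r<n vx<vp vp<vr
          vu<vr : v u < v r
          vu<vr = v-ascends (<-trans (<-trans u<k k<p) p<r) r<n λ vr<vu →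
            ¬3412 u<k k<p p<r r<n av3412 vp<vr vr<vu vu<vk
          ¬ascent-from-t : Tri (t < r) (t ≡ r) (r < t) → ⊥
          ¬ascent-from-t (tri< t<r _ _) = ¬123 s<t t<r r<n vs<vt (<-trans vt<vu vu<vr)
          ¬ascent-from-t (tri≈ _ t≡r _) = <-asym vt<vu (subst (λ x → v u < v x) (sym t≡r) vu<vr)
          ¬ascent-from-t (tri> _ _ r<t) = ¬3412 u<k k<p (<-trans p<r r<t) t<n av3412
            (<-trans (below-p (<-trans s<k k<p)) vs<vt) vt<vu vu<vk

    stackedAscents⇒formI : FormI π
    stackedAscents⇒formI with least (λ k → (u <? k) ×-dec ((k <? n) ×-dec (v u <? v k))) (u<w , w<n , vu<vw)
    ... | k , _ , (u<k , k<n , vu<vk) , first =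
      twoRuns⇒formI k (<⇒≤ k<n) (decreasing-before-k u<k k<n vu<vk first) (decreasing-from-k u<k k<n vu<vk first)

  -- If some ascent lies below q, the minimality of q yields an ascent bottom at least as high as its top.
  formI⊎formII : FormI π ⊎ FormII π
  formI⊎formII with least bottomsBelow? {n} (λ s<n _ → v<n s<n)
  ... | q , q≤n , bottoms<q , q-least with lowAscent? q
  ...   | no ¬low = inj₂ (¬lowAscent⇒formII q q≤n bottoms<q ¬low)
  ...   | yes (t , t<n , s , s<t , vs<vt , vt<q) with anyUpTo? (λ u → ascentBottom? u ×-dec (v t ≤? v u)) n
  ...     | no ¬high = ⊥-elim (q-least vt<q λ u<n bottom → ≰⇒> λ vt≤vu → ¬high (_ , u<n , bottom , vt≤vu))
  ...     | yes (u , _ , (w , w<n , u<w , vu<vw) , vt≤vu) =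
    inj₁ (stackedAscents⇒formI s<t t<n vs<vt u<w w<n vu<vw vt≤vu)

module NBeforeOne {N} {π : Permutation′ (suc N)}
  (av2341 : Avoids p2341 π) (av4123 : Avoids p4123 π) (av3412 : Avoids p3412 π)
  {a b} (a<b : a < b) (b<n : b < suc N) (va≡N : Values.v π a ≡ N) (vb≡0 : Values.v π b ≡ 0) where
  open Values π

  a<n : a < suc N
  a<n = <-trans a<b b<n

  v≤N : ∀ {k} → k < suc N → v k ≤ N
  v≤N k<n = ≤-pred (v<n k<n)

  vb<v : ∀ {k} → k < suc N → k ≢ b → v b < v k
  vb<v k<n k≢b = subst (_< _) (sym vb≡0) (n≢0⇒n>0 λ vk≡0 → k≢b (v-injective k<n b<n (trans vk≡0 (sym vb≡0))))

  v<va : ∀ {k} → k < suc N → k ≢ a → v k < v a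
  v<va k<n k≢a = subst (_ <_) (sym va≡N)
    (≤∧≢⇒< (v≤N k<n) λ vk≡N → k≢a (v-injective k<n a<n (trans vk≡N (sym va≡N))))

  decreasing-before-a : DecreasingOn 0 a
  decreasing-before-a {s} {t} _ s<t t<a t<n = v-descends s<t t<n λ vs<vt →
    ¬2341 s<t t<a a<b b<n av2341 (vb<v (<-trans s<t t<n) (<⇒≢ (<-trans s<t (<-trans t<a a<b)))) vs<vt (v<va t<n (<⇒≢ t<a))

  decreasing-after-b : DecreasingOn (suc b) (suc N)
  decreasing-after-b {s} {t} b<s s<t _ t<n = v-descends s<t t<n λ vs<vt →
    ¬4123 a<b b<s s<t t<n av4123 (vb<v (<-trans s<t t<n) (>⇒≢ b<s)) vs<vt (v<va t<n (>⇒≢ (<-trans a<b (<-trans b<s s<t))))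

  -- If 1 is the last entry, an occurrence of 123 would extend to 2341.
  1-last⇒avoids123 : b ≡ N → Avoids123
  1-last⇒avoids123 b≡N {s} {t} {u} s<t t<u u<n vs<vt vt<vu with m<1+n⇒m<n∨m≡n u<n
  ... | inj₁ u<N = ¬2341 s<t t<u u<b b<n av2341 (vb<v (<-trans s<t (<-trans t<u u<n)) (<⇒≢ (<-trans (<-trans s<t t<u) u<b)))
                     vs<vt vt<vu
    where
    u<b : u < b
    u<b = subst (u <_) (sym b≡N) u<N
  ... | inj₂ u≡N = n≮0 (subst (v t <_) (trans (cong v (trans u≡N (sym b≡N))) vb≡0) vt<vu)

  decreasing-a-to-b : DecreasingOn (suc a) b → DecreasingOn a (suc b)
  decreasing-a-to-b middle {s} {t} a≤s s<t t<1+b _ with m≤n⇒m<n∨m≡n a≤s | m<1+n⇒m<n∨m≡n t<1+b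
  ... | inj₂ refl | _ = v<va (≤-<-trans (≤-pred t<1+b) b<n) (>⇒≢ s<t)
  ... | inj₁ _ | inj₂ refl = vb<v (<-trans s<t b<n) (<⇒≢ s<t)
  ... | inj₁ a<s | inj₁ t<b = middle a<s s<t t<b (<-trans t<b b<n)

  -- The first entry bounds everything before n and, by 3412, lies below everything after 1.
  threshold : ∃ λ q → 0 < q × q ≤ suc N × (∀ {s} → s < a → v s < q) × (∀ {s} → b < s → s < suc N → q ≤ v s)
  threshold with m≤n⇒m<n∨m≡n (z≤n {a})
  ... | inj₂ 0≡a = 1 , z<s , s≤s z≤n , (λ s<a → contradiction (subst (_ <_) (sym 0≡a) s<a) n≮0) ,
                   λ b<s s<n → subst (_< _) vb≡0 (vb<v s<n (>⇒≢ b<s))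
  ... | inj₁ 0<a = suc (v 0) , z<s , v<n 0<n , (λ s<a → s≤s (v≤v0 s<a)) , v0<v
    where
    0<n : 0 < suc N
    0<n = <-trans 0<a a<n
    v≤v0 : ∀ {s} → s < a → v s ≤ v 0
    v≤v0 {zero} _ = ≤-refl
    v≤v0 {suc s} s<a = <⇒≤ (decreasing-before-a z≤n z<s s<a (<-trans s<a a<n))
    v0<v : ∀ {s} → b < s → s < suc N → v 0 < v s
    v0<v {s} b<s s<n = v-ascends (<-trans 0<a (<-trans a<b b<s)) s<n λ vs<v0 →
      ¬3412 0<a a<b b<s s<n av3412 (vb<v s<n (>⇒≢ b<s)) vs<v0 (v<va 0<n (<⇒≢ 0<a))

  middleDecreasing⇒formI : DecreasingOn (suc a) b → FormI π
  middleDecreasing⇒formI middle with threshold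
  ... | q , 0<q , q≤n , before<q , q≤after
    with least (λ k → (a ≤? k) ×-dec (v k <? q)) {b} (<⇒≤ a<b , subst (_< q) (sym vb≡0) 0<q)
  ... | k , k≤b , (a≤k , vk<q) , first =
    formI a k k (suc b) q q a≤k ≤-refl (≤-trans k≤b (n≤1+n b)) b<n ≤-refl q≤n
      decreasing-before-a
      (λ a≤s s<t t<k → decreasing-a-to-b middle a≤s s<t (<-≤-trans t<k (≤-trans k≤b (n≤1+n b))))
      (decreasingOn-empty k)
      (λ k≤s → decreasing-a-to-b middle (≤-trans a≤k k≤s))
      decreasing-after-b
      (λ _ s<a _ → z≤n , before<q s<a)
      (λ k≤s s≤b _ → z≤n , from-k k≤s (≤-pred s≤b))
      (valuesIn-empty k q q)
      (λ a≤s s<k s<n → ≮⇒≥ (λ vs<q → first s<k (a≤s , vs<q)) , v<n s<n)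
      (λ b<s _ s<n → q≤after b<s s<n , v<n s<n)
    where
    from-k : ∀ {s} → k ≤ s → s ≤ b → v s < q
    from-k k≤s s≤b with m≤n⇒m<n∨m≡n k≤s
    ... | inj₁ k<s = <-trans (decreasing-a-to-b middle a≤k k<s (s≤s s≤b) (≤-<-trans s≤b b<n)) vk<q
    ... | inj₂ refl = vk<q

  module _ (b<N : b < N) {i j} (a<i : a < i) (i<j : i < j) (j<b : j < b) (vi<vj : v i < v j) where

    N<n : N < suc N
    N<n = ≤-refl

    i<n : i < suc N
    i<n = <-trans i<j (<-trans j<b b<n)

    β : ℕ
    β = v N

    vb<β : v b < β
    vb<β = vb<v N<n (>⇒≢ b<N)

    β≤N : β ≤ N
    β≤N = v≤N N<n

    vN<va : v N < v a
    vN<va = v<va N<n (>⇒≢ (<-trans a<b b<N))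

    β≤after-b : ∀ {s} → b < s → s < suc N → β ≤ v s
    β≤after-b b<s s<n with m<1+n⇒m<n∨m≡n s<n
    ... | inj₁ s<N = <⇒≤ (decreasing-after-b b<s s<N N<n N<n)
    ... | inj₂ refl = ≤-refl

    after-b<vj : ∀ {s} → b < s → s < suc N → v s < v j
    after-b<vj b<s s<n = v-descends (<-trans j<b b<s) s<n λ vj<vs →
      ¬4123 a<i i<j (<-trans j<b b<s) s<n av4123 vi<vj vj<vs (v<va s<n (>⇒≢ (<-trans a<b b<s)))

    vi<before-a : ∀ {s} → s < a → v i < v s
    vi<before-a s<a = v-descends (<-trans s<a a<i) i<n λ vs<vi →
      ¬2341 (<-trans s<a a<i) i<j j<b b<n av2341 (vb<v (<-trans s<a a<n) (<⇒≢ (<-trans s<a a<b))) vs<vi vi<vj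

    before-a<β : ∀ {s} → s < a → v s < β
    before-a<β s<a = v-ascends (<-trans s<a (<-trans a<b b<N)) N<n λ vN<vs →
      ¬3412 s<a a<b b<N N<n av3412 vb<β vN<vs (v<va (<-trans s<a a<n) (<⇒≢ s<a))

    vi<β : v i < β
    vi<β = v-ascends (<-trans i<j (<-trans j<b b<N)) N<n λ vN<vi → ¬3412 i<j j<b b<N N<n av3412 vb<β vN<vi vi<vj

    β<v : ∀ {s} → s < N → β ≤ v s → β < v s
    β<v s<N β≤vs = ≤∧≢⇒< β≤vs λ β≡vs → <⇒≢ s<N (sym (v-injective N<n (<-trans s<N N<n) β≡vs))

    β<vj : β < v j
    β<vj = after-b<vj b<N N<n

    ¬ascent-below-β : ∀ {s t} → s < t → t < suc N → v s < v t → v t < β → ⊥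
    ¬ascent-below-β {s} {t} s<t t<n vs<vt vt<β with <-cmp t b | <-cmp t a | <-cmp s a | <-cmp i t
    ... | tri> _ _ b<t | _ | _ | _ = <⇒≱ vt<β (β≤after-b b<t t<n)
    ... | tri≈ _ refl _ | _ | _ | _ = n≮0 (subst (v s <_) vb≡0 vs<vt)
    ... | tri< _ _ _ | tri< t<a _ _ | _ | _ = <-asym vs<vt (decreasing-before-a z≤n s<t t<a t<n)
    ... | tri< _ _ _ | tri≈ _ refl _ | _ | _ = <⇒≱ (<-≤-trans vt<β β≤N) (≤-reflexive (sym va≡N))
    ... | tri< t<b _ _ | tri> _ _ _ | tri> _ _ a<s | _ =
      ¬4123 a<s s<t (<-trans t<b b<N) N<n av4123 vs<vt vt<β vN<va
    ... | tri< _ _ _ | tri> _ _ _ | tri≈ _ refl _ | _ = <⇒≱ vs<vt (subst (v t ≤_) (sym va≡N) (v≤N t<n))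
    ... | tri< t<b _ _ | tri> _ _ _ | tri< s<a _ _ | tri< i<t _ _ =
      ¬4123 a<i i<t (<-trans t<b b<N) N<n av4123 (<-trans (vi<before-a s<a) vs<vt) vt<β vN<va
    ... | tri< _ _ _ | tri> _ _ _ | tri< s<a _ _ | tri≈ _ refl _ = <-asym vs<vt (vi<before-a s<a)
    ... | tri< _ _ _ | tri> _ _ _ | tri< s<a _ _ | tri> _ _ t<i =
      ¬2341 s<t (<-trans t<i i<j) j<b b<n av2341 (vb<v (<-trans s<t t<n) (<⇒≢ (<-trans s<a a<b)))
        vs<vt (<-trans vt<β β<vj)

    ¬ascent-above-β : ∀ {s t} → s < t → t < suc N → v s < v t → β ≤ v s → ⊥
    ¬ascent-above-β {s} {t} s<t t<n vs<vt β≤vs with <-cmp s b | <-cmp s a | <-cmp t b | <-cmp i s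
    ... | tri> _ _ b<s | _ | _ | _ = <-asym vs<vt (decreasing-after-b b<s s<t t<n t<n)
    ... | tri≈ _ refl _ | _ | _ | _ = <⇒≱ vb<β β≤vs
    ... | tri< _ _ _ | tri< s<a _ _ | _ | _ = <⇒≱ (before-a<β s<a) β≤vs
    ... | tri< _ _ _ | tri≈ _ refl _ | _ | _ = <⇒≱ vs<vt (subst (v t ≤_) (sym va≡N) (v≤N t<n))
    ... | tri< s<b _ _ | tri> _ _ _ | tri< t<b _ _ | _ =
      ¬3412 s<t t<b b<N N<n av3412 vb<β (β<v (<-trans s<b b<N) β≤vs) vs<vt
    ... | tri< _ _ _ | tri> _ _ _ | tri≈ _ refl _ | _ = n≮0 (subst (v s <_) vb≡0 vs<vt)
    ... | tri< _ _ _ | tri> _ _ _ | tri> _ _ b<t | tri< i<s _ _ =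
      ¬4123 a<i i<s s<t t<n av4123 (<-≤-trans vi<β β≤vs) vs<vt (v<va t<n (>⇒≢ (<-trans a<b b<t)))
    ... | tri< _ _ _ | tri> _ _ _ | tri> _ _ _ | tri≈ _ refl _ = <⇒≱ vi<β β≤vs
    ... | tri< s<b _ _ | tri> _ _ _ | tri> _ _ b<t | tri> _ _ s<i =
      ¬3412 (<-trans s<i i<j) j<b b<N N<n av3412 vb<β (β<v (<-trans s<b b<N) β≤vs) (<-trans vs<vt (after-b<vj b<t t<n))

    middleAscent⇒formII : FormII π
    middleAscent⇒formII = formII β (<⇒≤ (v<n N<n))
      (λ s<t t<n _ vt<β → v-descends s<t t<n λ vs<vt → ¬ascent-below-β s<t t<n vs<vt vt<β)
      (λ s<t t<n β≤vs _ → v-descends s<t t<n λ vs<vt → ¬ascent-above-β s<t t<n vs<vt β≤vs)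

  formI⊎formII : FormI π ⊎ FormII π
  formI⊎formII with m<1+n⇒m<n∨m≡n b<n
  ... | inj₂ b≡N = Avoiding123And3412.formI⊎formII (1-last⇒avoids123 b≡N) av3412
  ... | inj₁ b<N with anyUpTo? (λ j → anyUpTo? (λ i → (a <? i) ×-dec (v i <? v j)) j) b
  ...   | yes (j , j<b , i , i<j , a<i , vi<vj) = inj₂ (middleAscent⇒formII b<N a<i i<j j<b vi<vj)
  ...   | no ¬ascent = inj₁ (middleDecreasing⇒formI λ a<s s<t t<b t<n →
                         v-descends s<t t<n λ vs<vt → ¬ascent (_ , t<b , _ , s<t , a<s , vs<vt))

proposition5 : (n : ℕ) (π : Permutation′ n) →
    Avoids p2341 π → Avoids p4123 π → Avoids p3412 π →
    NBefore1 π →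
    FormI π ⊎ FormII π
proposition5 zero π _ _ _ (() , _)
proposition5 (suc N) π av2341 av4123 av3412 (i , j , i<j , πi≡N , πj≡0) =
  NBeforeOne.formI⊎formII av2341 av4123 av3412 i<j (toℕ<n j) (trans (v-toℕ i) πi≡N) (trans (v-toℕ j) πj≡0)
  where open Values π
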